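{- Given a normalized basis of an order $\mathcal{O}$ of a quartic field, the following procedure computes a pair of ternary quadratic forms that parametrizes $\mathcal{O}$. (1) Compute $t \in \{1,2,3,4\}$: if $\ell \neq 0$, then $t=1$; if $\ell = 0$, $c_{11}^{(2)} \neq 0$, then $t=2$; if $\ell = 0 = c_{11}^{(2)}$, $c_{11}^{(3)} \neq 0$, then $t=3$; if $\ell = 0 = c_{11}^{(2)} = c_{11}^{(3)}$, $c_{12}^{(3)} \neq 0$, then $t=4$. (2) Construct the matrix $M_t$, where $$M_1 = \begin{pmatrix} -\ell & c_{11}^{(2)} & c_{11}^{(3)} & 0 & 0 & 0 \\ 0 & c_{23}^{(3)} & -c_{22}^{(3)} & -\ell & 0 & 0 \\ 0 & m & n & 0 & -\ell & 0 \\ 0 & -c_{33}^{(2)} & c_{23}^{(2)} & 0 & 0 & -\ell\end{pmatrix},\quad M_2 = \begin{pmatrix} 0 & -c_{11}^{(2)} & -c_{11}^{(3)} & 0 & 0 & 0 \\ c_{23}^{(3)} & 0 & -c_{12}^{(3)} & -c_{11}^{(2)} & 0 & 0 \\ m & 0 & -c_{13}^{(3)} & 0 & -c_{11}^{(2)} & 0 \\ -c_{33}^{(2)} & 0 & c_{13}^{(2)} & 0 & 0 & -c_{11}^{(2)}\end{pmatrix},$$ $$M_3 = \begin{pmatrix} 0 & 0 & c_{11}^{(3)} & 0 & 0 & 0 \\ c_{22}^{(3)} & -c_{12}^{(3)} & 0 & c_{11}^{(3)} & 0 & 0 \\ -n & -c_{13}^{(3)} & 0 & 0 & c_{11}^{(3)}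 & 0 \\ -c_{23}^{(2)} & c_{13}^{(2)} & 0 & 0 & 0 & c_{11}^{(3)}\end{pmatrix},\quad M_4 = \begin{pmatrix} -c_{22}^{(3)} & c_{12}^{(3)} & 0 & 0 & 0 & 0 \\ -c_{23}^{(3)} & 0 & c_{12}^{(3)} & 0 & 0 & 0 \\ c_{22}^{(1)} & 0 & 0 & -c_{13}^{(3)} & c_{12}^{(3)} & 0 \\ c_{23}^{(1)} & 0 & 0 & c_{13}^{(2)} & 0 & c_{12}^{(3)}\end{pmatrix}.$$ (3) Compute the row-style Hermite normal form $(U \mid V)$ of $(M_t^{\top} \mid I_6)$, where the entries of $V \in \mathrm{GL}_6(\mathbb{Z})$ are denoted $v_{ij}$. (4) Define the integer $k$ by $k = \ell/(v_{52}v_{63} - v_{53}v_{62})$ if $t=1$; $k = c_{11}^{(2)}/(v_{51}v_{63})$ if $t=2$; $k = -c_{11}^{(3)}/(v_{51}v_{62})$ if $t=3$; $k = -c_{12}^{(3)}/(v_{51}v_{64})$ if $t=4$. (5) Output the pair of ternary quadratic forms $\mathcal{Q}_A = (a_{11},a_{12},a_{13},a_{22},a_{23},a_{33}) = k(v_{51},v_{52},v_{53},v_{54},v_{55},v_{56})$ and $\mathcal{Q}_B = (b_{11},b_{12},b_{13},b_{22},b_{23},b_{33}) = (0,v_{62},v_{63},v_{64},v_{65},v_{66})$, which parametrizes the order $\mathcal{O}$.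
   Context: $\mathcal{O}$ is an order of a quartic field with normalized basis $\{1,\omega_1,\omega_2,\omega_3\}$, i.e. $\omega_i\omega_j = \sum_{k=0}^3 c_{ij}^{(k)}\omega_k$ ($\omega_0=1$) with $c_{12}^{(1)} = c_{12}^{(2)} = c_{13}^{(1)} = 0$. Define $\ell = c_{13}^{(3)} - c_{11}^{(1)}$, $m = c_{33}^{(3)} - c_{23}^{(2)}$, $n = c_{22}^{(2)} - c_{23}^{(3)}$. A ternary quadratic form $(a_{11},a_{12},a_{13},a_{22},a_{23},a_{33})$ denotes $a_{11}x^2 + a_{12}xy + a_{13}xz + a_{22}y^2 + a_{23}yz + a_{33}z^2$; "parametrizes $\mathcal{O}$" refers to Bhargava's correspondence between pairs of ternary quadratic forms and quartic rings, under which the pair gives the normalized basis with $c_{11}^{(1)} = a_{13}b_{12} - a_{12}b_{13} + a_{23}b_{11} - a_{11}b_{23}$, $c_{11}^{(2)} = a_{11}b_{13} - a_{13}b_{11}$, $c_{11}^{(3)} = a_{12}b_{11} - a_{11}b_{12}$, $c_{12}^{(3)} = a_{22}b_{11} - a_{11}b_{22}$, $c_{13}^{(2)} = a_{11}b_{33} - a_{33}b_{11}$, $c_{13}^{(3)} = a_{23}b_{11} - a_{11}b_{23}$, $c_{22}^{(1)} = a_{23}b_{22} - a_{22}b_{23}$, $c_{22}^{(2)} = a_{12}b_{23} - a_{23}b_{12} + a_{22}b_{13} - a_{13}b_{22}$, $c_{22}^{(3)} = a_{22}b_{12} - a_{12}b_{22}$, $c_{23}^{(1)} = a_{33}b_{22}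 - a_{22}b_{33}$, $c_{23}^{(2)} = a_{12}b_{33} - a_{33}b_{12}$, $c_{23}^{(3)} = a_{22}b_{13} - a_{13}b_{22}$, $c_{33}^{(1)} = a_{33}b_{23} - a_{23}b_{33}$, $c_{33}^{(2)} = a_{13}b_{33} - a_{33}b_{13}$, $c_{33}^{(3)} = a_{12}b_{33} - a_{33}b_{12} + a_{23}b_{13} - a_{13}b_{23}$. At least one of the four cases for $t$ always occurs for an order of a quartic field. -}

module Defs where

open import Data.Nat as ℕ using (ℕ; zero; suc)
open import Data.Fin using (Fin; zero; suc; toℕ; #_; splitAt; _<_)
open import Data.Integer using (ℤ; _+_; _*_; -_; _-_; 0ℤ; 1ℤ; _≤_) renaming (_<_ to _<ℤ_)
open import Data.Product using (Σ; _×_; _,_)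
open import Data.Sum using (_⊎_; [_,_]′)
open import Relation.Binary.PropositionalEquality using (_≡_; _≢_)

∑ : (n : ℕ) → (Fin n → ℤ) → ℤ
∑ zero    f = 0ℤ
∑ (suc n) f = f zero + ∑ n (λ i → f (suc i))

Mat : ℕ → ℕ → Set
Mat r s = Fin r → Fin s → ℤ

infixl 7 _⊗_
_⊗_ : {r s t : ℕ} → Mat r s → Mat s t → Mat r t
_⊗_ {s = s} A B i j = ∑ s (λ k → A i k * B k j)

δ : {n : ℕ} → Fin n → Fin n → ℤ
δ zero    zero    = 1ℤ
δ zero    (suc j) = 0ℤ
δ (suc i) zero    = 0ℤ
δ (suc i) (suc j) = δ i j

idMat : {n : ℕ} → Mat n n
idMat = δ

transpose : {r s : ℕ} → Mat r s → Mat s r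
transpose A i j = A j i

_∣∣_ : {r s t : ℕ} → Mat r s → Mat r t → Mat r (s ℕ.+ t)
_∣∣_ {s = s} A B i j = [ A i , B i ]′ (splitAt s j)

IsUnimodular : {n : ℕ} → Mat n n → Set
IsUnimodular {n} W = Σ (Mat n n) λ W' → (W ⊗ W' ≡ idMat) × (W' ⊗ W ≡ idMat)

-- row-style Hermite normal form: rows 0..r-1 are nonzero with strictly
-- increasing pivot columns, positive pivots, entries above a pivot reduced
-- into [0, pivot); rows r..m-1 are zero.
IsHNF : {m n : ℕ} → Mat m n → Set
IsHNF {m} {n} H =
  Σ ℕ λ r → Σ (Fin m → Fin n) λ piv →
      (∀ i → r ℕ.≤ toℕ i → ∀ j → H i j ≡ 0ℤ)
    × (∀ i → toℕ i ℕ.< r → (∀ j → j < piv i → H i j ≡ 0ℤ) × (0ℤ <ℤ H i (piv i)))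
    × (∀ i i' → toℕ i ℕ.< toℕ i' → toℕ i' ℕ.< r → piv i < piv i')
    × (∀ i i' → toℕ i' ℕ.< toℕ i → toℕ i ℕ.< r →
         (0ℤ ≤ H i' (piv i)) × (H i' (piv i) <ℤ H i (piv i)))

IsHNFOf : {m n : ℕ} → Mat m n → Mat m n → Set
IsHNFOf {m} A H = Σ (Mat m m) λ W → IsUnimodular W × (H ≡ W ⊗ A) × IsHNF H

-- Quartic rings given by structure constants w.r.t. a basis
-- {ω₀ = 1, ω₁, ω₂, ω₃}:  ω_i ω_j = ∑_k c i j k ω_k.

StructConst : Set
StructConst = Fin 4 → Fin 4 → Fin 4 → ℤ

mulO : StructConst → (Fin 4 → ℤ) → (Fin 4 → ℤ) → Fin 4 → ℤ
mulO c x y k = ∑ 4 λ i → ∑ 4 λ j → x i * y j * c i j k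

-- c is the multiplication table of an order in a quartic field, with
-- ω₀ = 1: a commutative, associative ring structure on ℤ⁴ with identity ω₀
-- and without zero divisors (so that ⊗ ℚ is a field of degree 4).
record IsQuarticOrder (c : StructConst) : Set where
  field
    unitL  : ∀ j k → c zero j k ≡ δ j k
    comm   : ∀ i j k → c i j k ≡ c j i k
    assoc  : ∀ i j k n → ∑ 4 (λ p → c i j p * c p k n) ≡ ∑ 4 (λ p → c j k p * c i p n)
    domain : ∀ x y → (∀ k → mulO c x y k ≡ 0ℤ) → (∀ k → x k ≡ 0ℤ) ⊎ (∀ k → y k ≡ 0ℤ)

module _ (c : StructConst) where
  c11¹ c11² c11³ c12¹ c12² c12³ c13¹ c13² c13³ : ℤ
  c22¹ c22² c22³ c23¹ c23² c23³ c33¹ c33² c33³ : ℤ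
  c11¹ = c (# 1) (# 1) (# 1)
  c11² = c (# 1) (# 1) (# 2)
  c11³ = c (# 1) (# 1) (# 3)
  c12¹ = c (# 1) (# 2) (# 1)
  c12² = c (# 1) (# 2) (# 2)
  c12³ = c (# 1) (# 2) (# 3)
  c13¹ = c (# 1) (# 3) (# 1)
  c13² = c (# 1) (# 3) (# 2)
  c13³ = c (# 1) (# 3) (# 3)
  c22¹ = c (# 2) (# 2) (# 1)
  c22² = c (# 2) (# 2) (# 2)
  c22³ = c (# 2) (# 2) (# 3)
  c23¹ = c (# 2) (# 3) (# 1)
  c23² = c (# 2) (# 3) (# 2)
  c23³ = c (# 2) (# 3) (# 3)
  c33¹ = c (# 3) (# 3) (# 1)
  c33² = c (# 3) (# 3) (# 2)
  c33³ = c (# 3) (# 3) (# 3)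

  IsNormalized : Set
  IsNormalized = (c12¹ ≡ 0ℤ) × (c12² ≡ 0ℤ) × (c13¹ ≡ 0ℤ)

  ℓ m n : ℤ
  ℓ = c13³ - c11¹
  m = c33³ - c23²
  n = c22² - c23³

  private
    rows : (r₀ r₁ r₂ r₃ : Fin 6 → ℤ) → Mat 4 6
    rows r₀ r₁ r₂ r₃ zero = r₀
    rows r₀ r₁ r₂ r₃ (suc zero) = r₁
    rows r₀ r₁ r₂ r₃ (suc (suc zero)) = r₂
    rows r₀ r₁ r₂ r₃ (suc (suc (suc zero))) = r₃

    row : (a₀ a₁ a₂ a₃ a₄ a₅ : ℤ) → Fin 6 → ℤ
    row a₀ a₁ a₂ a₃ a₄ a₅ zero = a₀
    row a₀ a₁ a₂ a₃ a₄ a₅ (suc zero) = a₁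
    row a₀ a₁ a₂ a₃ a₄ a₅ (suc (suc zero)) = a₂
    row a₀ a₁ a₂ a₃ a₄ a₅ (suc (suc (suc zero))) = a₃
    row a₀ a₁ a₂ a₃ a₄ a₅ (suc (suc (suc (suc zero)))) = a₄
    row a₀ a₁ a₂ a₃ a₄ a₅ (suc (suc (suc (suc (suc zero))))) = a₅

  M₁ M₂ M₃ M₄ : Mat 4 6
  M₁ = rows (row (- ℓ) c11² c11³ 0ℤ 0ℤ 0ℤ)
            (row 0ℤ c23³ (- c22³) (- ℓ) 0ℤ 0ℤ)
            (row 0ℤ m n 0ℤ (- ℓ) 0ℤ)
            (row 0ℤ (- c33²) c23² 0ℤ 0ℤ (- ℓ))
  M₂ = rows (row 0ℤ (- c11²) (- c11³) 0ℤ 0ℤ 0ℤ)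
            (row c23³ 0ℤ (- c12³) (- c11²) 0ℤ 0ℤ)
            (row m 0ℤ (- c13³) 0ℤ (- c11²) 0ℤ)
            (row (- c33²) 0ℤ c13² 0ℤ 0ℤ (- c11²))
  M₃ = rows (row 0ℤ 0ℤ c11³ 0ℤ 0ℤ 0ℤ)
            (row c22³ (- c12³) 0ℤ c11³ 0ℤ 0ℤ)
            (row (- n) (- c13³) 0ℤ 0ℤ c11³ 0ℤ)
            (row (- c23²) c13² 0ℤ 0ℤ 0ℤ c11³)
  M₄ = rows (row (- c22³) c12³ 0ℤ 0ℤ 0ℤ 0ℤ)
            (row (- c23³) 0ℤ c12³ 0ℤ 0ℤ 0ℤ)
            (row c22¹ 0ℤ 0ℤ (- c13³) c12³ 0ℤ)
            (row c23¹ 0ℤ 0ℤ c13² 0ℤ c12³)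

  -- A pair of ternary quadratic forms (a11,a12,a13,a22,a23,a33),
  -- (b11,...,b33), each given as a function Fin 6 → ℤ in that order,
  -- parametrizes the order with structure constants c (Bhargava's
  -- correspondence, normalized basis).
  Parametrizes : (A B : Fin 6 → ℤ) → Set
  Parametrizes A B =
      (c11¹ ≡ a13 * b12 - a12 * b13 + a23 * b11 - a11 * b23)
    × (c11² ≡ a11 * b13 - a13 * b11)
    × (c11³ ≡ a12 * b11 - a11 * b12)
    × (c12³ ≡ a22 * b11 - a11 * b22)
    × (c13² ≡ a11 * b33 - a33 * b11)
    × (c13³ ≡ a23 * b11 - a11 * b23)
    × (c22¹ ≡ a23 * b22 - a22 * b23)
    × (c22² ≡ a12 * b23 - a23 * b12 + a22 * b13 - a13 * b22)
    × (c22³ ≡ a22 * b12 - a12 * b22)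
    × (c23¹ ≡ a33 * b22 - a22 * b33)
    × (c23² ≡ a12 * b33 - a33 * b12)
    × (c23³ ≡ a22 * b13 - a13 * b22)
    × (c33¹ ≡ a33 * b23 - a23 * b33)
    × (c33² ≡ a13 * b33 - a33 * b13)
    × (c33³ ≡ a12 * b33 - a33 * b12 + a23 * b13 - a13 * b23)
    where
    a11 = A (# 0) ; a12 = A (# 1) ; a13 = A (# 2)
    a22 = A (# 3) ; a23 = A (# 4) ; a33 = A (# 5)
    b11 = B (# 0) ; b12 = B (# 1) ; b13 = B (# 2)
    b22 = B (# 3) ; b23 = B (# 4) ; b33 = B (# 5)

-- The algorithm, steps (3)-(5), for a given matrix M_t and a given
-- numerator num_t and denominator den_t (a function of V) defining k:
-- for (U | V) the row-style HNF of (M_tᵀ | I₆), k := num_t / den_t is a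
-- well-defined integer (den_t ≠ 0, den_t ∣ num_t) and
--   Q_A = k (v51,…,v56),  Q_B = (0, v62,…,v66)
-- parametrizes the order.

-- v i j (1-based in the paper) is  V (# (i-1)) (# (j-1)).
QB : Mat 6 6 → Fin 6 → ℤ
QB V zero    = 0ℤ
QB V (suc j) = V (# 5) (suc j)

AlgorithmOutputParametrizes : StructConst → Mat 4 6 → ℤ → (Mat 6 6 → ℤ) → Set
AlgorithmOutputParametrizes c M num den =
  ∀ (U : Mat 6 4) (V : Mat 6 6) →
  IsHNFOf (transpose M ∣∣ idMat) (U ∣∣ V) →
  Σ ℤ λ k → (den V ≢ 0ℤ) × (num ≡ k * den V) ×
            Parametrizes c (λ j → k * V (# 4) j) (QB V)

module Submission where

-- Bhargava's formulas say that the structure constants are signed sums of the 2 × 2 minors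
-- of the 2 × 6 matrix with rows A, B; so (A, B) parametrises the order iff these minors
-- equal a vector γ read off from the constants.  In case t, M_t is built from a pivot pair
-- (i, j) with γ_ij ≠ 0, and its kernel is cut out by γ_ij vₜ = γ_tj vᵢ + γ_it vⱼ.
-- Associativity makes γ satisfy the Plücker relations, which force the minors of any two
-- kernel vectors p, q to be proportional to γ.  The last two rows of V are such p, q and
-- extend to a unimodular matrix, so by Cauchy–Binet their minors form a primitive vector:
-- hence γ = k · minors(p, q) for the integer k = γ_ij / (minor in columns i, j).

open import Defs
open import Data.Fin using (#_)
open import Data.Integer using (ℤ; _*_; _-_; -_; 0ℤ)
open import Data.Product using (_×_)
open import Relation.Binary.PropositionalEquality using (_≡_; _≢_)

open import Data.Empty using (⊥-elim)
open import Data.Fin using (Fin; zero; suc; toℕ; fromℕ<; _↑ˡ_; _↑ʳ_; _<_)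
open import Data.Fin.Properties using (<-cmp; <-irrefl; <-asym; splitAt-↑ˡ; toℕ-↑ˡ; toℕ<n; toℕ-fromℕ<)
open import Data.Integer using (_+_; 1ℤ)
open import Data.Integer.Base using (≢-nonZero)
import Data.Integer.Properties as ℤP
open import Data.Integer.Tactic.RingSolver using (solve-∀)
open import Data.List using (List; []; _∷_)
open import Data.List.Relation.Unary.All as All using (All; []; _∷_)
open import Data.Nat as ℕ using (ℕ; z≤n; s≤s)
import Data.Nat.Properties as ℕP
open import Data.Product using (Σ; _,_; proj₁; proj₂; uncurry)
open import Data.Sum using ([_,_]′)
open import Function using (_$_)
open import Relation.Binary.Definitions using (tri<; tri≈; tri>)
open import Relation.Binary.PropositionalEquality
  using (refl; sym; trans; cong; cong₂; subst; module ≡-Reasoning)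
open import Relation.Nullary using (yes; no)

pattern 𝟎 = zero
pattern 𝟏 = suc 𝟎
pattern 𝟐 = suc 𝟏
pattern 𝟑 = suc 𝟐
pattern 𝟒 = suc 𝟑
pattern 𝟓 = suc 𝟒

byZero : ∀ {x y d : ℤ} → x - y ≡ d → d ≡ 0ℤ → x ≡ y
byZero {x} {y} x-y≡d refl = ℤP.i-j≡0⇒i≡j x y x-y≡d

diff≡0 : ∀ {x y : ℤ} → x ≡ y → x - y ≡ 0ℤ
diff≡0 {x} refl = ℤP.+-inverseʳ x

cancelˡ : ∀ e {x y : ℤ} → e ≢ 0ℤ → e * x ≡ e * y → x ≡ y
cancelˡ e {x} {y} e≢0 = ℤP.*-cancelˡ-≡ e x y {{≢-nonZero e≢0}}

neg≢0 : ∀ {a : ℤ} → a ≢ 0ℤ → - a ≢ 0ℤ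
neg≢0 {a} a≢0 -a≡0 = a≢0 (trans (sym (ℤP.neg-involutive a)) (cong -_ -a≡0))

infix 7 _·_
_·_ : ∀ {n} → (Fin n → ℤ) → (Fin n → ℤ) → ℤ
_·_ {n} u v = ∑ n (λ t → u t * v t)

∑-cong : ∀ n {f g : Fin n → ℤ} → (∀ i → f i ≡ g i) → ∑ n f ≡ ∑ n g
∑-cong ℕ.zero    f≗g = refl
∑-cong (ℕ.suc n) f≗g = cong₂ _+_ (f≗g zero) (∑-cong n (λ i → f≗g (suc i)))

∑-zero : ∀ n (f : Fin n → ℤ) → ∑ n (λ k → 0ℤ * f k) ≡ 0ℤ
∑-zero ℕ.zero    f = refl
∑-zero (ℕ.suc n) f = trans (ℤP.+-identityˡ _) (∑-zero n (λ k → f (suc k)))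

·-δ : ∀ n (f : Fin n → ℤ) t → f · (λ k → δ k t) ≡ f t
·-δ (ℕ.suc n) f zero    = trans (cong₂ _+_ (ℤP.*-identityʳ (f zero)) vanish) (ℤP.+-identityʳ (f zero))
  where
  vanish : ∑ n (λ k → f (suc k) * 0ℤ) ≡ 0ℤ
  vanish = trans (∑-cong n (λ k → ℤP.*-zeroʳ (f (suc k)))) (∑-zero n (λ _ → 0ℤ))
·-δ (ℕ.suc n) f (suc t) =
  trans (cong (_+ ∑ n (λ k → f (suc k) * δ k t)) (ℤP.*-zeroʳ (f zero))) (trans (ℤP.+-identityˡ _) (·-δ n (λ k → f (suc k)) t))

pivot≥row : ∀ {m n} r (piv : Fin m → Fin n) →
  (∀ i i' → toℕ i ℕ.< toℕ i' → toℕ i' ℕ.< r → piv i < piv i') →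
  ∀ k (k<m : k ℕ.< m) → k ℕ.< r → k ℕ.≤ toℕ (piv (fromℕ< k<m))
pivot≥row r piv increasing ℕ.zero    _      _      = z≤n
pivot≥row r piv increasing (ℕ.suc k) 1+k<m 1+k<r =
  ℕP.<-≤-trans (s≤s (pivot≥row r piv increasing k k<m k<r))
               (increasing (fromℕ< k<m) (fromℕ< 1+k<m) earlier current)
  where
  k<m = ℕP.<-trans (ℕP.n<1+n k) 1+k<m
  k<r = ℕP.<-trans (ℕP.n<1+n k) 1+k<r
  earlier : toℕ (fromℕ< k<m) ℕ.< toℕ (fromℕ< 1+k<m)
  earlier rewrite toℕ-fromℕ< k<m | toℕ-fromℕ< 1+k<m = ℕP.n<1+n k
  current : toℕ (fromℕ< 1+k<m) ℕ.< r
  current rewrite toℕ-fromℕ< 1+k<m = 1+k<r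

-- What the algorithm uses from the Hermite normal form (U | V) of (Mᵀ | I₆): the last two
-- rows p, q of V solve M x = 0, q starts with 0, and (being rows of an invertible matrix)
-- they admit dual vectors w, w′.
record LastRows (M : Mat 4 6) (p q : Fin 6 → ℤ) : Set where
  field
    p∈ker  : ∀ r → p · M r ≡ 0ℤ
    q∈ker  : ∀ r → q · M r ≡ 0ℤ
    q₀≡0   : q 𝟎 ≡ 0ℤ
    w w′   : Fin 6 → ℤ
    p·w≡1  : p · w ≡ 1ℤ
    p·w′≡0 : p · w′ ≡ 0ℤ
    q·w≡0  : q · w ≡ 0ℤ
    q·w′≡1 : q · w′ ≡ 1ℤ

lastRows : (M : Mat 4 6) (U : Mat 6 4) (V : Mat 6 6) →
  IsHNFOf (transpose M ∣∣ idMat) (U ∣∣ V) → LastRows M (V 𝟒) (V 𝟓)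
lastRows M U V (W , (W′ , WW′≡I , _) , H≡WA , (r , piv , zeroRows , pivots , increasing , _)) =
  record
    { p∈ker = kernelRow 4 {4<6} ℕP.≤-refl r>4 ; q∈ker = kernelRow 5 {5<6} (ℕP.n≤1+n 4) r>5
    ; q₀≡0 = leftOfPivot 5 {5<6} r>5 (4 ↑ʳ 𝟎) (ℕP.n<1+n 4)
    ; w = λ t → W′ t 𝟒 ; w′ = λ t → W′ t 𝟓
    ; p·w≡1 = dual 𝟒 𝟒 ; p·w′≡0 = dual 𝟒 𝟓 ; q·w≡0 = dual 𝟓 𝟒 ; q·w′≡1 = dual 𝟓 𝟓
    }
  where
  A = transpose M ∣∣ idMat
  5<6 = ℕP.n<1+n 5
  4<6 = ℕP.<-trans (ℕP.n<1+n 4) 5<6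
  entry : ∀ a col → (U ∣∣ V) a col ≡ (W ⊗ A) a col
  entry a col = cong (λ X → X a col) H≡WA

  -- the identity block shows that V is the transformation matrix W itself
  V≡W : ∀ a t → V a t ≡ W a t
  V≡W a t = trans (entry a (4 ↑ʳ t)) (·-δ 6 (W a) t)

  dual : ∀ a b → V a · (λ t → W′ t b) ≡ δ a b
  dual a b = trans (∑-cong 6 (λ t → cong (_* W′ t b) (V≡W a t))) (cong (λ X → X a b) WW′≡I)

  -- no row of the invertible matrix V vanishes, so all six rows of the HNF are nonzero
  r>5 : 5 ℕ.< r
  r>5 with r ℕ.≤? 5
  ... | no  r≰5 = ℕP.≰⇒> r≰5
  ... | yes r≤5 = ⊥-elim (1≢0 (trans (sym (dual 𝟓 𝟓)) lastRow·w′≡0))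
    where
    1≢0 : 1ℤ ≢ 0ℤ
    1≢0 ()
    lastRow·w′≡0 : V 𝟓 · (λ t → W′ t 𝟓) ≡ 0ℤ
    lastRow·w′≡0 = trans (∑-cong 6 (λ t → cong (_* W′ t 𝟓) (zeroRows 𝟓 r≤5 (4 ↑ʳ t))))
                         (∑-zero 6 (λ t → W′ t 𝟓))

  r>4 : 4 ℕ.< r
  r>4 = ℕP.<-trans (ℕP.n<1+n 4) r>5

  leftOfPivot : ∀ k {k<6 : k ℕ.< 6} → k ℕ.< r → ∀ col → toℕ col ℕ.< k → (U ∣∣ V) (fromℕ< k<6) col ≡ 0ℤ
  leftOfPivot k {k<6} k<r col col<k =
    proj₁ (pivots (fromℕ< k<6) (subst (ℕ._< r) (sym (toℕ-fromℕ< k<6)) k<r)) col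
          (ℕP.<-≤-trans col<k (pivot≥row r piv increasing k k<6 k<r))

  -- the first four columns of W A are W Mᵀ, so rows k ≥ 4 of V are orthogonal to the rows of M
  kernelRow : ∀ k {k<6 : k ℕ.< 6} → 4 ℕ.≤ k → k ℕ.< r → ∀ j → V (fromℕ< k<6) · M j ≡ 0ℤ
  kernelRow k {k<6} 4≤k k<r j = begin
    V a · M j                  ≡⟨ ∑-cong 6 (λ t → cong (_* M j t) (V≡W a t)) ⟩
    W a · M j                  ≡⟨ ∑-cong 6 (λ t → cong (λ s → W a t * [ transpose M t , idMat t ]′ s)
                                                         (sym (splitAt-↑ˡ 4 j 6))) ⟩
    (W ⊗ A) a (j ↑ˡ 6)         ≡⟨ sym (entry a (j ↑ˡ 6)) ⟩
    (U ∣∣ V) a (j ↑ˡ 6)        ≡⟨ leftOfPivot k {k<6} k<r (j ↑ˡ 6) j<k ⟩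
    0ℤ                         ∎
    where
    open ≡-Reasoning
    a = fromℕ< k<6
    j<k : toℕ (j ↑ˡ 6) ℕ.< k
    j<k = subst (ℕ._< k) (sym (toℕ-↑ˡ j 6)) (ℕP.<-≤-trans (toℕ<n j) 4≤k)

pairs : List (Fin 6 × Fin 6)
pairs = (𝟎 , 𝟏) ∷ (𝟎 , 𝟐) ∷ (𝟎 , 𝟑) ∷ (𝟎 , 𝟒) ∷ (𝟎 , 𝟓) ∷
        (𝟏 , 𝟐) ∷ (𝟏 , 𝟑) ∷ (𝟏 , 𝟒) ∷ (𝟏 , 𝟓) ∷
        (𝟐 , 𝟑) ∷ (𝟐 , 𝟒) ∷ (𝟐 , 𝟓) ∷
        (𝟑 , 𝟒) ∷ (𝟑 , 𝟓) ∷ (𝟒 , 𝟓) ∷ []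

sumOver : {A : Set} → List A → (A → ℤ) → ℤ
sumOver []       f = 0ℤ
sumOver (x ∷ xs) f = f x + sumOver xs f

minor : (p q : Fin 6 → ℤ) → Fin 6 × Fin 6 → ℤ
minor p q (s , t) = p s * q t - p t * q s

cauchyBinet : ∀ p q w w′ →
  sumOver pairs (λ st → minor p q st * minor w w′ st) ≡ (p · w) * (q · w′) - (p · w′) * (q · w)
cauchyBinet p q w w′ =
  identity (p 𝟎) (p 𝟏) (p 𝟐) (p 𝟑) (p 𝟒) (p 𝟓) (q 𝟎) (q 𝟏) (q 𝟐) (q 𝟑) (q 𝟒) (q 𝟓)
           (w 𝟎) (w 𝟏) (w 𝟐) (w 𝟑) (w 𝟒) (w 𝟓) (w′ 𝟎) (w′ 𝟏) (w′ 𝟐) (w′ 𝟑) (w′ 𝟒) (w′ 𝟓)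
  where
  identity : ∀ p0 p1 p2 p3 p4 p5 q0 q1 q2 q3 q4 q5 a0 a1 a2 a3 a4 a5 b0 b1 b2 b3 b4 b5 →
    (p0 * q1 - p1 * q0) * (a0 * b1 - a1 * b0) + ((p0 * q2 - p2 * q0) * (a0 * b2 - a2 * b0)
    + ((p0 * q3 - p3 * q0) * (a0 * b3 - a3 * b0) + ((p0 * q4 - p4 * q0) * (a0 * b4 - a4 * b0)
    + ((p0 * q5 - p5 * q0) * (a0 * b5 - a5 * b0) + ((p1 * q2 - p2 * q1) * (a1 * b2 - a2 * b1)
    + ((p1 * q3 - p3 * q1) * (a1 * b3 - a3 * b1) + ((p1 * q4 - p4 * q1) * (a1 * b4 - a4 * b1)
    + ((p1 * q5 - p5 * q1) * (a1 * b5 - a5 * b1) + ((p2 * q3 - p3 * q2) * (a2 * b3 - a3 * b2)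
    + ((p2 * q4 - p4 * q2) * (a2 * b4 - a4 * b2) + ((p2 * q5 - p5 * q2) * (a2 * b5 - a5 * b2)
    + ((p3 * q4 - p4 * q3) * (a3 * b4 - a4 * b3) + ((p3 * q5 - p5 * q3) * (a3 * b5 - a5 * b3)
    + ((p4 * q5 - p5 * q4) * (a4 * b5 - a5 * b4) + 0ℤ))))))))))))))
    ≡ (p0 * a0 + (p1 * a1 + (p2 * a2 + (p3 * a3 + (p4 * a4 + (p5 * a5 + 0ℤ))))))
      * (q0 * b0 + (q1 * b1 + (q2 * b2 + (q3 * b3 + (q4 * b4 + (q5 * b5 + 0ℤ))))))
      - (p0 * b0 + (p1 * b1 + (p2 * b2 + (p3 * b3 + (p4 * b4 + (p5 * b5 + 0ℤ))))))
      * (q0 * a0 + (q1 * a1 + (q2 * a2 + (q3 * a3 + (q4 * a4 + (q5 * a5 + 0ℤ))))))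
  identity = solve-∀

-- An integer vector γ proportional to a primitive vector P (one with ∑ Pₓ ρₓ = 1 for some
-- ρ) is an integer multiple of it: from γₓ D = e Pₓ with e ≠ 0 we get γ = k P and e = k D,
-- where k = ∑ γₓ ρₓ.
module _ {A : Set} (xs : List A) (P ρ γ : A → ℤ) (e D : ℤ) where

  private
    scaled : All (λ x → γ x * D ≡ e * P x) xs →
             sumOver xs (λ x → γ x * ρ x) * D ≡ e * sumOver xs (λ x → P x * ρ x)
    scaled = go xs
      where
      open ≡-Reasoning
      go : ∀ ys → All (λ x → γ x * D ≡ e * P x) ys →
           sumOver ys (λ x → γ x * ρ x) * D ≡ e * sumOver ys (λ x → P x * ρ x)
      go []       []       = sym (ℤP.*-zeroʳ e)
      go (y ∷ ys) (h ∷ hs) = begin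
        (γ y * ρ y + sumOver ys (λ x → γ x * ρ x)) * D
          ≡⟨ distrib (γ y) (ρ y) _ D ⟩
        (γ y * D) * ρ y + sumOver ys (λ x → γ x * ρ x) * D
          ≡⟨ cong₂ (λ u v → u * ρ y + v) h (go ys hs) ⟩
        (e * P y) * ρ y + e * sumOver ys (λ x → P x * ρ x)
          ≡⟨ collect e (P y) (ρ y) _ ⟩
        e * (P y * ρ y + sumOver ys (λ x → P x * ρ x)) ∎
        where
        distrib : ∀ g r S D → (g * r + S) * D ≡ (g * D) * r + S * D
        distrib = solve-∀
        collect : ∀ e p r S → (e * p) * r + e * S ≡ e * (p * r + S)
        collect = solve-∀

  proportional⇒multiple : e ≢ 0ℤ → sumOver xs (λ x → P x * ρ x) ≡ 1ℤ →
    All (λ x → γ x * D ≡ e * P x) xs →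
    Σ ℤ λ k → (e ≡ k * D) × All (λ x → k * P x ≡ γ x) xs
  proportional⇒multiple e≢0 ∑Pρ≡1 proportional = k , e≡kD , All.map kP≡γ proportional
    where
    open ≡-Reasoning
    k = sumOver xs (λ x → γ x * ρ x)
    e≡kD : e ≡ k * D
    e≡kD = sym (begin
      k * D                                ≡⟨ scaled proportional ⟩
      e * sumOver xs (λ x → P x * ρ x)     ≡⟨ cong (e *_) ∑Pρ≡1 ⟩
      e * 1ℤ                               ≡⟨ ℤP.*-identityʳ e ⟩
      e                                    ∎)
    swap : ∀ a b c → a * (b * c) ≡ b * (a * c)
    swap = solve-∀
    kP≡γ : ∀ {x} → γ x * D ≡ e * P x → k * P x ≡ γ x
    kP≡γ {x} γD≡eP = cancelˡ e e≢0 (begin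
      e * (k * P x)   ≡⟨ swap e k (P x) ⟩
      k * (e * P x)   ≡⟨ cong (k *_) (sym γD≡eP) ⟩
      k * (γ x * D)   ≡⟨ swap k (γ x) D ⟩
      γ x * (k * D)   ≡⟨ cong (γ x *_) (sym e≡kD) ⟩
      γ x * e         ≡⟨ ℤP.*-comm (γ x) e ⟩
      e * γ x         ∎)

record Alternating {n} (g : Fin n → Fin n → ℤ) : Set where
  field
    antisym : ∀ s t → g s t ≡ - g t s
    diag    : ∀ s → g s s ≡ 0ℤ

antisymmetrise : ∀ {n} → (Fin n → Fin n → ℤ) → Fin n → Fin n → ℤ
antisymmetrise f s t with <-cmp s t
... | tri< _ _ _ = f s t
... | tri≈ _ _ _ = 0ℤ
... | tri> _ _ _ = - f t s

antisymmetrise-alternating : ∀ {n} (f : Fin n → Fin n → ℤ) → Alternating (antisymmetrise f)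
antisymmetrise-alternating f = record { antisym = antisym ; diag = diag }
  where
  antisym : ∀ s t → antisymmetrise f s t ≡ - antisymmetrise f t s
  antisym s t with <-cmp s t | <-cmp t s
  ... | tri< _   _   _   | tri> _   _   _   = sym (ℤP.neg-involutive (f s t))
  ... | tri≈ _   _   _   | tri≈ _   _   _   = refl
  ... | tri> _   _   _   | tri< _   _   _   = refl
  ... | tri< s<t _   _   | tri< t<s _   _   = ⊥-elim (<-asym s<t t<s)
  ... | tri< _   s≢t _   | tri≈ _   t≡s _   = ⊥-elim (s≢t (sym t≡s))
  ... | tri≈ _   s≡t _   | tri< _   t≢s _   = ⊥-elim (t≢s (sym s≡t))
  ... | tri≈ _   s≡t _   | tri> _   t≢s _   = ⊥-elim (t≢s (sym s≡t))
  ... | tri> _   s≢t _   | tri≈ _   t≡s _   = ⊥-elim (s≢t (sym t≡s))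
  ... | tri> _   _   t<s | tri> _   _   s<t = ⊥-elim (<-asym s<t t<s)
  diag : ∀ s → antisymmetrise f s s ≡ 0ℤ
  diag s with <-cmp s s
  ... | tri< s<s _ _ = ⊥-elim (<-irrefl refl s<s)
  ... | tri≈ _   _ _ = refl
  ... | tri> _   _ s<s = ⊥-elim (<-irrefl refl s<s)

Pl₄ : (Fin 6 → Fin 6 → ℤ) → (a b c d : Fin 6) → ℤ
Pl₄ g a b c d = g a b * g c d - g a c * g b d + g a d * g b c

-- The Plücker relations in the form needed relative to a pivot pair (i, j):
-- g_sj g_it − g_tj g_is = g_ij g_st.  (A record, so that g, i, j and the pair (s , t) can
-- be recovered from the type.)
record PlückerAt (g : Fin 6 → Fin 6 → ℤ) (i j : Fin 6) (st : Fin 6 × Fin 6) : Set where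
  constructor plücker-at
  field
    relation : g (proj₁ st) j * g i (proj₂ st) - g (proj₂ st) j * g i (proj₁ st) ≡ g i j * uncurry g st

-- For an alternating g, PlückerAt g i j (s , t) holds outright when {s, t} meets {i, j};
-- otherwise it is one of the relations Pl₄ = 0, up to the order of the four indices.
module PlückerForms {g : Fin 6 → Fin 6 → ℤ} (alt : Alternating g) where
  open Alternating alt

  starts-at-i : ∀ {i j t} → PlückerAt g i j (i , t)
  starts-at-i {i} {j} {t} = plücker-at $
    trans (cong (λ x → g i j * g i t - g t j * x) (diag i)) (identity (g i j) (g i t) (g t j))
    where
    identity : ∀ x y z → x * y - z * 0ℤ ≡ x * y
    identity = solve-∀

  starts-at-j : ∀ {i j t} → PlückerAt g i j (j , t)
  starts-at-j {i} {j} {t} = plücker-at $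
    trans (cong₂ (λ x y → x * g i t - y * g i j) (diag j) (antisym t j))
          (identity (g i j) (g i t) (g j t))
    where
    identity : ∀ x y w → 0ℤ * y - (- w) * x ≡ x * w
    identity = solve-∀

  ends-at-i : ∀ {i j s} → PlückerAt g i j (s , i)
  ends-at-i {i} {j} {s} = plücker-at $
    trans (cong₂ (λ x y → g s j * x - g i j * y) (diag i) (antisym i s))
          (identity (g i j) (g s j) (g s i))
    where
    identity : ∀ x z w → z * 0ℤ - x * (- w) ≡ x * w
    identity = solve-∀

  ends-at-j : ∀ {i j s} → PlückerAt g i j (s , j)
  ends-at-j {i} {j} {s} = plücker-at $
    trans (cong (λ x → g s j * g i j - x * g i s) (diag j)) (identity (g i j) (g s j) (g i s))
    where
    identity : ∀ x y z → y * x - 0ℤ * z ≡ x * y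
    identity = solve-∀

  -- The four interleavings of a pivot pair i < j with a disjoint pair s < t that occur,
  -- written with a < b < c < d: (i, j, s, t) = (a, b, c, d), (b, c, a, d), (a, c, b, d), (a, d, b, c).
  disjoint-abcd : ∀ {a b c d} → Pl₄ g a b c d ≡ 0ℤ → PlückerAt g a b (c , d)
  disjoint-abcd {a} {b} {c} {d} pl = plücker-at $
    trans (cong₂ (λ x y → x * g a d - y * g a c) (antisym c b) (antisym d b))
          (byZero (identity (g a b) (g a c) (g a d) (g b c) (g b d) (g c d)) (cong -_ pl))
    where
    identity : ∀ ab ac ad bc bd cd →
      (- bc) * ad - (- bd) * ac - ab * cd ≡ - (ab * cd - ac * bd + ad * bc)
    identity = solve-∀

  disjoint-bcad : ∀ {a b c d} → Pl₄ g a b c d ≡ 0ℤ → PlückerAt g b c (a , d)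
  disjoint-bcad {a} {b} {c} {d} pl = plücker-at $
    trans (cong₂ (λ x y → g a c * g b d - x * y) (antisym d c) (antisym b a))
          (byZero (identity (g a b) (g a c) (g a d) (g b c) (g b d) (g c d)) (cong -_ pl))
    where
    identity : ∀ ab ac ad bc bd cd →
      ac * bd - (- cd) * (- ab) - bc * ad ≡ - (ab * cd - ac * bd + ad * bc)
    identity = solve-∀

  disjoint-acbd : ∀ {a b c d} → Pl₄ g a b c d ≡ 0ℤ → PlückerAt g a c (b , d)
  disjoint-acbd {a} {b} {c} {d} pl = plücker-at $
    trans (cong (λ x → g b c * g a d - x * g a b) (antisym d c))
          (byZero (identity (g a b) (g a c) (g a d) (g b c) (g b d) (g c d)) pl)
    where
    identity : ∀ ab ac ad bc bd cd →
      bc * ad - (- cd) * ab - ac * bd ≡ ab * cd - ac * bd + ad * bc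
    identity = solve-∀

  disjoint-adbc : ∀ {a b c d} → Pl₄ g a b c d ≡ 0ℤ → PlückerAt g a d (b , c)
  disjoint-adbc {a} {b} {c} {d} pl = plücker-at $
    byZero (identity (g a b) (g a c) (g a d) (g b c) (g b d) (g c d)) (cong -_ pl)
    where
    identity : ∀ ab ac ad bc bd cd →
      bd * ac - cd * ab - ad * bc ≡ - (ab * cd - ac * bd + ad * bc)
    identity = solve-∀

KernelEquation : (g : Fin 6 → Fin 6 → ℤ) (i j : Fin 6) (v : Fin 6 → ℤ) → Fin 6 → Set
KernelEquation g i j v t = g i j * v t ≡ g t j * v i + g i t * v j

det-multiplicative : ∀ e ps pt qs qt pi pj qi qj as at bs bt →
  e * ps ≡ as * pi + bs * pj → e * pt ≡ at * pi + bt * pj →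
  e * qs ≡ as * qi + bs * qj → e * qt ≡ at * qi + bt * qj →
  e * (e * (ps * qt - pt * qs)) ≡ (as * bt - at * bs) * (pi * qj - pj * qi)
det-multiplicative e ps pt qs qt pi pj qi qj as at bs bt eps ept eqs eqt = begin
  e * (e * (ps * qt - pt * qs))
    ≡⟨ expand e ps pt qs qt ⟩
  (e * ps) * (e * qt) - (e * pt) * (e * qs)
    ≡⟨ cong₂ _-_ (cong₂ _*_ eps eqt) (cong₂ _*_ ept eqs) ⟩
  (as * pi + bs * pj) * (at * qi + bt * qj) - (at * pi + bt * pj) * (as * qi + bs * qj)
    ≡⟨ factor pi pj qi qj as at bs bt ⟩
  (as * bt - at * bs) * (pi * qj - pj * qi) ∎
  where
  open ≡-Reasoning
  expand : ∀ e ps pt qs qt → e * (e * (ps * qt - pt * qs)) ≡ (e * ps) * (e * qt) - (e * pt) * (e * qs)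
  expand = solve-∀
  factor : ∀ pi pj qi qj as at bs bt →
    (as * pi + bs * pj) * (at * qi + bt * qj) - (at * pi + bt * pj) * (as * qi + bs * qj)
    ≡ (as * bt - at * bs) * (pi * qj - pj * qi)
  factor = solve-∀

minors-proportional : ∀ {g i j p q} → g i j ≢ 0ℤ →
  (∀ t → KernelEquation g i j p t) → (∀ t → KernelEquation g i j q t) →
  ∀ {st} → PlückerAt g i j st → uncurry g st * minor p q (i , j) ≡ g i j * minor p q st
minors-proportional {g} {i} {j} {p} {q} e≢0 kp kq {s , t} (plücker-at plücker) = cancelˡ e e≢0 (begin
  e * (g s t * D)                        ≡⟨ sym (ℤP.*-assoc e (g s t) D) ⟩
  (e * g s t) * D                        ≡⟨ cong (_* D) (sym plücker) ⟩
  (g s j * g i t - g t j * g i s) * D    ≡⟨ sym (det-multiplicative e (p s) (p t) (q s) (q t)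
                                               (p i) (p j) (q i) (q j) (g s j) (g t j) (g i s) (g i t)
                                               (kp s) (kp t) (kq s) (kq t)) ⟩
  e * (e * minor p q (s , t))            ∎)
  where
  open ≡-Reasoning
  e = g i j
  D = minor p q (i , j)

-- The Plücker vector of the order: γ_st is the value that Bhargava's formulas prescribe for
-- the minor in columns (s, t) of the pair of forms, columns indexed by the coefficients
-- (11, 12, 13, 22, 23, 33).
γ⁺ : StructConst → Fin 6 → Fin 6 → ℤ
γ⁺ c 𝟎 𝟏 = - c11³ c
γ⁺ c 𝟎 𝟐 = c11² c
γ⁺ c 𝟎 𝟑 = - c12³ c
γ⁺ c 𝟎 𝟒 = - c13³ c
γ⁺ c 𝟎 𝟓 = c13² c
γ⁺ c 𝟏 𝟐 = ℓ c
γ⁺ c 𝟏 𝟑 = - c22³ c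
γ⁺ c 𝟏 𝟒 = n c
γ⁺ c 𝟏 𝟓 = c23² c
γ⁺ c 𝟐 𝟑 = - c23³ c
γ⁺ c 𝟐 𝟒 = - m c
γ⁺ c 𝟐 𝟓 = c33² c
γ⁺ c 𝟑 𝟒 = - c22¹ c
γ⁺ c 𝟑 𝟓 = - c23¹ c
γ⁺ c 𝟒 𝟓 = - c33¹ c
γ⁺ c _ _ = 0ℤ

γ : StructConst → Fin 6 → Fin 6 → ℤ
γ c = antisymmetrise (γ⁺ c)

swapped : ∀ (A B : Fin 6 → ℤ) s t {g} → minor A B (s , t) ≡ - g → g ≡ minor A B (t , s)
swapped A B s t {g} h = byZero (identity (A s) (B t) (A t) (B s) g) (diff≡0 h)
  where
  identity : ∀ x y z w g → g - (z * w - x * y) ≡ (x * y - z * w) - (- g)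
  identity = solve-∀

-- Bhargava's formulas state exactly that the minors of (A, B) are the entries of γ: the
-- fifteen constants are, in order, −m₁₂ − m₀₄, m₀₂, −m₀₁, −m₀₃, m₀₅, −m₀₄, −m₃₄, m₁₄ − m₂₃,
-- −m₁₃, −m₃₅, m₁₅, −m₂₃, −m₄₅, m₂₅, m₁₅ − m₂₄ for the minors m_st of (A, B).
minors⇒parametrizes : ∀ c A B → All (λ st → minor A B st ≡ uncurry (γ c) st) pairs →
  Parametrizes c A B
minors⇒parametrizes c A B
  (h01 ∷ h02 ∷ h03 ∷ h04 ∷ h05 ∷ h12 ∷ h13 ∷ h14 ∷ h15 ∷ h23 ∷ h24 ∷ h25 ∷ h34 ∷ h35 ∷ h45 ∷ []) =
      byZero (c11¹-identity (A 𝟎) (A 𝟏) (A 𝟐) (A 𝟒) (B 𝟎) (B 𝟏) (B 𝟐) (B 𝟒) (c11¹ c) (c13³ c))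
             (cong₂ _+_ (diff≡0 h12) (diff≡0 h04))
    , sym h02
    , swapped A B 𝟎 𝟏 h01
    , swapped A B 𝟎 𝟑 h03
    , sym h05
    , swapped A B 𝟎 𝟒 h04
    , swapped A B 𝟑 𝟒 h34
    , byZero (c22²-identity (A 𝟏) (A 𝟐) (A 𝟑) (A 𝟒) (B 𝟏) (B 𝟐) (B 𝟑) (B 𝟒) (c22² c) (c23³ c))
             (cong₂ _-_ (diff≡0 h23) (diff≡0 h14))
    , swapped A B 𝟏 𝟑 h13
    , swapped A B 𝟑 𝟓 h35
    , sym h15
    , swapped A B 𝟐 𝟑 h23
    , swapped A B 𝟒 𝟓 h45
    , sym h25
    , byZero (c33³-identity (A 𝟏) (A 𝟐) (A 𝟒) (A 𝟓) (B 𝟏) (B 𝟐) (B 𝟒) (B 𝟓) (c33³ c) (c23² c))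
             (cong₂ _-_ (diff≡0 h24) (diff≡0 h15))
  where
  c11¹-identity : ∀ a11 a12 a13 a23 b11 b12 b13 b23 c111 c133 →
    c111 - (a13 * b12 - a12 * b13 + a23 * b11 - a11 * b23)
    ≡ (a12 * b13 - a13 * b12 - (c133 - c111)) + (a11 * b23 - a23 * b11 - (- c133))
  c11¹-identity = solve-∀
  c22²-identity : ∀ a12 a13 a22 a23 b12 b13 b22 b23 c222 c233 →
    c222 - (a12 * b23 - a23 * b12 + a22 * b13 - a13 * b22)
    ≡ (a13 * b22 - a22 * b13 - (- c233)) - (a12 * b23 - a23 * b12 - (c222 - c233))
  c22²-identity = solve-∀
  c33³-identity : ∀ a12 a13 a23 a33 b12 b13 b23 b33 c333 c232 →
    c333 - (a12 * b33 - a33 * b12 + a23 * b13 - a13 * b23)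
    ≡ (a13 * b23 - a23 * b13 - (- (c333 - c232))) - (a12 * b33 - a33 * b12 - c232)
  c33³-identity = solve-∀

-- The output pair (k v₅, Q_B) has k times the minors of the last two rows of V, since Q_B
-- agrees with the last row once its first entry vanishes.
output-minors : ∀ k (V : Mat 6 6) → V 𝟓 𝟎 ≡ 0ℤ →
  ∀ st → minor (λ t → k * V 𝟒 t) (QB V) st ≡ k * minor (V 𝟒) (V 𝟓) st
output-minors k V q₀≡0 (s , t) =
  trans (cong₂ (λ x y → (k * V 𝟒 s) * x - (k * V 𝟒 t) * y) (QB≗q t) (QB≗q s))
        (identity k (V 𝟒 s) (V 𝟒 t) (V 𝟓 s) (V 𝟓 t))
  where
  QB≗q : ∀ t → QB V t ≡ V 𝟓 t
  QB≗q 𝟎       = sym q₀≡0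
  QB≗q (suc t) = refl
  identity : ∀ k ps pt qs qt → (k * ps) * qt - (k * pt) * qs ≡ k * (ps * qt - pt * qs)
  identity = solve-∀

-- The minors of those rows are then proportional to γ and primitive, so
-- γ = k · (minors) with k = γ_ij / den.
algorithm-correct : (c : StructConst) (M : Mat 4 6) (i j : Fin 6) (den : Mat 6 6 → ℤ) →
  γ c i j ≢ 0ℤ →
  (∀ v → (∀ r → v · M r ≡ 0ℤ) → ∀ t → KernelEquation (γ c) i j v t) →
  All (PlückerAt (γ c) i j) pairs →
  (∀ V → V 𝟓 𝟎 ≡ 0ℤ → den V ≡ minor (V 𝟒) (V 𝟓) (i , j)) →
  AlgorithmOutputParametrizes c M (γ c i j) den
algorithm-correct c M i j den e≢0 kernel plücker den≡D U V hnf =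
  k , den≢0 , trans e≡kD (cong (k *_) (sym (den≡D V q₀≡0))) ,
  minors⇒parametrizes c (λ t → k * V 𝟒 t) (QB V) (All.map (λ {st} → trans (output-minors k V q₀≡0 st)) kP≡γ)
  where
  open LastRows (lastRows M U V hnf)
  e = γ c i j
  P = minor (V 𝟒) (V 𝟓)
  D = P (i , j)

  proportional : All (λ st → uncurry (γ c) st * D ≡ e * P st) pairs
  proportional = All.map (minors-proportional {γ c} {i} {j} {V 𝟒} {V 𝟓} e≢0 (kernel (V 𝟒) p∈ker) (kernel (V 𝟓) q∈ker)) plücker

  P-primitive : sumOver pairs (λ st → P st * minor w w′ st) ≡ 1ℤ
  P-primitive = trans (cauchyBinet (V 𝟒) (V 𝟓) w w′)
                      (cong₂ _-_ (cong₂ _*_ p·w≡1 q·w′≡1) (cong₂ _*_ p·w′≡0 q·w≡0))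

  multiple = proportional⇒multiple pairs P (minor w w′) (uncurry (γ c)) e D e≢0 P-primitive proportional
  k    = proj₁ multiple
  e≡kD = proj₁ (proj₂ multiple)
  kP≡γ = proj₂ (proj₂ multiple)

  den≢0 : den V ≢ 0ℤ
  den≢0 den≡0 = e≢0 (trans e≡kD (trans (cong (k *_) (trans (sym (den≡D V q₀≡0)) den≡0)) (ℤP.*-zeroʳ k)))

leading-minor : ∀ (V : Mat 6 6) t → V 𝟓 𝟎 ≡ 0ℤ → V 𝟒 𝟎 * V 𝟓 t ≡ minor (V 𝟒) (V 𝟓) (𝟎 , t)
leading-minor V t q₀≡0 =
  sym (trans (cong (λ x → V 𝟒 𝟎 * V 𝟓 t - V 𝟒 t * x) q₀≡0) (identity (V 𝟒 𝟎 * V 𝟓 t) (V 𝟒 t)))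
  where
  identity : ∀ x y → x - y * 0ℤ ≡ x
  identity = solve-∀

-- The multiplication table with the unit ω₀ = 1 and the normalisation c₁₂¹ = c₁₂² = c₁₃¹ = 0
-- built in, so that its entries at fixed indices compute to 0, 1 or a constant c i j k with
-- 1 ≤ i ≤ j.
N⁺ : StructConst → StructConst
N⁺ c 𝟏 𝟐 𝟏 = 0ℤ
N⁺ c 𝟏 𝟐 𝟐 = 0ℤ
N⁺ c 𝟏 𝟑 𝟏 = 0ℤ
N⁺ c i j k = c i j k

N : StructConst → StructConst
N c 𝟎       j k = δ j k
N c (suc i) 𝟎 k = δ (suc i) k
N c 𝟐 𝟏 k = N⁺ c 𝟏 𝟐 k
N c 𝟑 𝟏 k = N⁺ c 𝟏 𝟑 k
N c 𝟑 𝟐 k = N⁺ c 𝟐 𝟑 k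
N c i j k = N⁺ c i j k

module Constants (c : StructConst) where
  c110 c111 c112 c113 c120 c123 c130 c132 c133 : ℤ
  c110 = c 𝟏 𝟏 𝟎 ; c111 = c 𝟏 𝟏 𝟏 ; c112 = c 𝟏 𝟏 𝟐 ; c113 = c 𝟏 𝟏 𝟑
  c120 = c 𝟏 𝟐 𝟎 ; c123 = c 𝟏 𝟐 𝟑
  c130 = c 𝟏 𝟑 𝟎 ; c132 = c 𝟏 𝟑 𝟐 ; c133 = c 𝟏 𝟑 𝟑
  c220 c221 c222 c223 c230 c231 c232 c233 c330 c331 c332 c333 : ℤ
  c220 = c 𝟐 𝟐 𝟎 ; c221 = c 𝟐 𝟐 𝟏 ; c222 = c 𝟐 𝟐 𝟐 ; c223 = c 𝟐 𝟐 𝟑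
  c230 = c 𝟐 𝟑 𝟎 ; c231 = c 𝟐 𝟑 𝟏 ; c232 = c 𝟐 𝟑 𝟐 ; c233 = c 𝟐 𝟑 𝟑
  c330 = c 𝟑 𝟑 𝟎 ; c331 = c 𝟑 𝟑 𝟏 ; c332 = c 𝟑 𝟑 𝟐 ; c333 = c 𝟑 𝟑 𝟑

-- The Plücker vector γ of a normalised quartic order satisfies the Plücker relations: each
-- relation Pl₄ = 0 used below is one associativity law, or the sum of two, where
-- assocN i j k n is the ω_n-coordinate of (ω_i ω_j) ω_k = ω_i (ω_j ω_k).
module PlückerRelations (c : StructConst) (Q : IsQuarticOrder c) (normalised : IsNormalized c) where
  open IsQuarticOrder Q
  open Constants c

  private
    norm⁺ : ∀ i j k → c i j k ≡ N⁺ c i j k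
    norm⁺ 𝟏 𝟐 𝟏 = proj₁ normalised
    norm⁺ 𝟏 𝟐 𝟐 = proj₁ (proj₂ normalised)
    norm⁺ 𝟏 𝟑 𝟏 = proj₂ (proj₂ normalised)
    norm⁺ 𝟏 𝟐 𝟎 = refl
    norm⁺ 𝟏 𝟐 𝟑 = refl
    norm⁺ 𝟏 𝟑 𝟎 = refl
    norm⁺ 𝟏 𝟑 𝟐 = refl
    norm⁺ 𝟏 𝟑 𝟑 = refl
    norm⁺ 𝟏 𝟎 k = refl
    norm⁺ 𝟏 𝟏 k = refl
    norm⁺ 𝟎 j k = refl
    norm⁺ (suc (suc i)) j k = refl

    norm : ∀ i j k → c i j k ≡ N c i j k
    norm 𝟎       j k = unitL j k
    norm (suc i) 𝟎 k = trans (comm (suc i) 𝟎 k) (unitL (suc i) k)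
    norm 𝟐 𝟏 k = trans (comm 𝟐 𝟏 k) (norm⁺ 𝟏 𝟐 k)
    norm 𝟑 𝟏 k = trans (comm 𝟑 𝟏 k) (norm⁺ 𝟏 𝟑 k)
    norm 𝟑 𝟐 k = trans (comm 𝟑 𝟐 k) (norm⁺ 𝟐 𝟑 k)
    norm 𝟏 (suc j) k = norm⁺ 𝟏 (suc j) k
    norm 𝟐 (suc (suc j)) k = norm⁺ 𝟐 (suc (suc j)) k
    norm 𝟑 𝟑 k = norm⁺ 𝟑 𝟑 k

    assocN : ∀ i j k n → ∑ 4 (λ p → N c i j p * N c p k n) ≡ ∑ 4 (λ p → N c j k p * N c i p n)
    assocN i j k n = begin
      ∑ 4 (λ p → N c i j p * N c p k n) ≡⟨ ∑-cong 4 (λ p → sym (cong₂ _*_ (norm i j p) (norm p k n))) ⟩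
      ∑ 4 (λ p → c i j p * c p k n)     ≡⟨ assoc i j k n ⟩
      ∑ 4 (λ p → c j k p * c i p n)     ≡⟨ ∑-cong 4 (λ p → cong₂ _*_ (norm j k p) (norm i p n)) ⟩
      ∑ 4 (λ p → N c j k p * N c i p n) ∎
      where open ≡-Reasoning

    viaAssoc₁ : ∀ {x L R} → x ≡ L - R → L ≡ R → x ≡ 0ℤ
    viaAssoc₁ x≡L-R L≡R = trans x≡L-R (diff≡0 L≡R)

    viaAssoc₂ : ∀ {x L R L′ R′} → x ≡ (L - R) + (L′ - R′) → L ≡ R → L′ ≡ R′ → x ≡ 0ℤ
    viaAssoc₂ x≡… L≡R L′≡R′ = trans x≡… (cong₂ _+_ (diff≡0 L≡R) (diff≡0 L′≡R′))

  plücker₀₁₂₃ : Pl₄ (γ c) 𝟎 𝟏 𝟐 𝟑 ≡ 0ℤ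
  plücker₀₁₂₃ = viaAssoc₁ (identity c110 c111 c112 c113 c120 c123 c133 c223 c233)
    (assocN 𝟏 𝟏 𝟐 𝟑)
    where
    identity : ∀ c110 c111 c112 c113 c120 c123 c133 c223 c233 →
      (- c113) * (- c233) - c112 * (- c223) + (- c123) * (c133 - c111)
      ≡ (c110 * 0ℤ + (c111 * c123 + (c112 * c223 + (c113 * c233 + 0ℤ))))
        - (c120 * 0ℤ + (0ℤ * c113 + (0ℤ * c123 + (c123 * c133 + 0ℤ))))
    identity = solve-∀

  plücker₀₁₂₄ : Pl₄ (γ c) 𝟎 𝟏 𝟐 𝟒 ≡ 0ℤ
  plücker₀₁₂₄ = viaAssoc₂ (identity c110 c111 c112 c113 c120 c123 c130 c132 c133 c222 c232 c233 c333)
    (sym (assocN 𝟏 𝟏 𝟐 𝟐)) (assocN 𝟏 𝟏 𝟑 𝟑)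
    where
    identity : ∀ c110 c111 c112 c113 c120 c123 c130 c132 c133 c222 c232 c233 c333 →
      (- c113) * (- (c333 - c232)) - c112 * (c222 - c233) + (- c133) * (c133 - c111)
      ≡ ((c120 * 0ℤ + (0ℤ * c112 + (0ℤ * 0ℤ + (c123 * c132 + 0ℤ))))
          - (c110 * 1ℤ + (c111 * 0ℤ + (c112 * c222 + (c113 * c232 + 0ℤ)))))
        + ((c110 * 1ℤ + (c111 * c133 + (c112 * c233 + (c113 * c333 + 0ℤ))))
          - (c130 * 0ℤ + (0ℤ * c113 + (c132 * c123 + (c133 * c133 + 0ℤ)))))
    identity = solve-∀

  plücker₀₁₂₅ : Pl₄ (γ c) 𝟎 𝟏 𝟐 𝟓 ≡ 0ℤ
  plücker₀₁₂₅ = viaAssoc₁ (identity c110 c111 c112 c113 c130 c132 c133 c232 c332)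
    (sym (assocN 𝟏 𝟏 𝟑 𝟐))
    where
    identity : ∀ c110 c111 c112 c113 c130 c132 c133 c232 c332 →
      (- c113) * c332 - c112 * c232 + c132 * (c133 - c111)
      ≡ (c130 * 0ℤ + (0ℤ * c112 + (c132 * 0ℤ + (c133 * c132 + 0ℤ))))
        - (c110 * 0ℤ + (c111 * c132 + (c112 * c232 + (c113 * c332 + 0ℤ))))
    identity = solve-∀

  plücker₀₁₃₄ : Pl₄ (γ c) 𝟎 𝟏 𝟑 𝟒 ≡ 0ℤ
  plücker₀₁₃₄ = viaAssoc₁ (identity c113 c120 c123 c133 c220 c221 c222 c223 c233)
    (sym (assocN 𝟏 𝟐 𝟐 𝟑))
    where
    identity : ∀ c113 c120 c123 c133 c220 c221 c222 c223 c233 →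
      (- c113) * (- c221) - (- c123) * (c222 - c233) + (- c133) * (- c223)
      ≡ (c220 * 0ℤ + (c221 * c113 + (c222 * c123 + (c223 * c133 + 0ℤ))))
        - (c120 * 0ℤ + (0ℤ * c123 + (0ℤ * c223 + (c123 * c233 + 0ℤ))))
    identity = solve-∀

  plücker₀₁₃₅ : Pl₄ (γ c) 𝟎 𝟏 𝟑 𝟓 ≡ 0ℤ
  plücker₀₁₃₅ = viaAssoc₂ (identity c110 c111 c112 c113 c120 c123 c132 c220 c221 c222 c223 c231 c232)
    (assocN 𝟏 𝟏 𝟐 𝟏) (assocN 𝟏 𝟐 𝟐 𝟐)
    where
    identity : ∀ c110 c111 c112 c113 c120 c123 c132 c220 c221 c222 c223 c231 c232 →
      (- c113) * (- c231) - (- c123) * c232 + c132 * (- c223)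
      ≡ ((c110 * 0ℤ + (c111 * 0ℤ + (c112 * c221 + (c113 * c231 + 0ℤ))))
          - (c120 * 1ℤ + (0ℤ * c111 + (0ℤ * 0ℤ + (c123 * 0ℤ + 0ℤ)))))
        + ((c120 * 1ℤ + (0ℤ * 0ℤ + (0ℤ * c222 + (c123 * c232 + 0ℤ))))
          - (c220 * 0ℤ + (c221 * c112 + (c222 * 0ℤ + (c223 * c132 + 0ℤ)))))
    identity = solve-∀

  plücker₀₁₄₅ : Pl₄ (γ c) 𝟎 𝟏 𝟒 𝟓 ≡ 0ℤ
  plücker₀₁₄₅ = viaAssoc₂ (identity c110 c111 c112 c113 c130 c132 c133 c222 c230 c231 c232 c233 c331)
    (assocN 𝟏 𝟏 𝟑 𝟏) (assocN 𝟏 𝟑 𝟐 𝟐)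
    where
    identity : ∀ c110 c111 c112 c113 c130 c132 c133 c222 c230 c231 c232 c233 c331 →
      (- c113) * (- c331) - (- c133) * c232 + c132 * (c222 - c233)
      ≡ ((c110 * 0ℤ + (c111 * 0ℤ + (c112 * c231 + (c113 * c331 + 0ℤ))))
          - (c130 * 1ℤ + (0ℤ * c111 + (c132 * 0ℤ + (c133 * 0ℤ + 0ℤ)))))
        + ((c130 * 1ℤ + (0ℤ * 0ℤ + (c132 * c222 + (c133 * c232 + 0ℤ))))
          - (c230 * 0ℤ + (c231 * c112 + (c232 * 0ℤ + (c233 * c132 + 0ℤ)))))
    identity = solve-∀

  plücker₀₂₃₄ : Pl₄ (γ c) 𝟎 𝟐 𝟑 𝟒 ≡ 0ℤ
  plücker₀₂₃₄ = viaAssoc₂ (identity c110 c111 c112 c113 c120 c123 c133 c221 c230 c231 c232 c233 c333)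
    (sym (assocN 𝟏 𝟏 𝟐 𝟏)) (sym (assocN 𝟏 𝟐 𝟑 𝟑))
    where
    identity : ∀ c110 c111 c112 c113 c120 c123 c133 c221 c230 c231 c232 c233 c333 →
      c112 * (- c221) - (- c123) * (- (c333 - c232)) + (- c133) * (- c233)
      ≡ ((c120 * 1ℤ + (0ℤ * c111 + (0ℤ * 0ℤ + (c123 * 0ℤ + 0ℤ))))
          - (c110 * 0ℤ + (c111 * 0ℤ + (c112 * c221 + (c113 * c231 + 0ℤ)))))
        + ((c230 * 0ℤ + (c231 * c113 + (c232 * c123 + (c233 * c133 + 0ℤ))))
          - (c120 * 1ℤ + (0ℤ * c133 + (0ℤ * c233 + (c123 * c333 + 0ℤ)))))
    identity = solve-∀

  plücker₀₂₃₅ : Pl₄ (γ c) 𝟎 𝟐 𝟑 𝟓 ≡ 0ℤ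
  plücker₀₂₃₅ = viaAssoc₁ (identity c112 c120 c123 c132 c230 c231 c232 c233 c332)
    (assocN 𝟏 𝟐 𝟑 𝟐)
    where
    identity : ∀ c112 c120 c123 c132 c230 c231 c232 c233 c332 →
      c112 * (- c231) - (- c123) * c332 + c132 * (- c233)
      ≡ (c120 * 0ℤ + (0ℤ * c132 + (0ℤ * c232 + (c123 * c332 + 0ℤ))))
        - (c230 * 0ℤ + (c231 * c112 + (c232 * 0ℤ + (c233 * c132 + 0ℤ))))
    identity = solve-∀

  plücker₀₂₄₅ : Pl₄ (γ c) 𝟎 𝟐 𝟒 𝟓 ≡ 0ℤ
  plücker₀₂₄₅ = viaAssoc₁ (identity c112 c130 c132 c133 c232 c330 c331 c332 c333)
    (assocN 𝟏 𝟑 𝟑 𝟐)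
    where
    identity : ∀ c112 c130 c132 c133 c232 c330 c331 c332 c333 →
      c112 * (- c331) - (- c133) * c332 + c132 * (- (c333 - c232))
      ≡ (c130 * 0ℤ + (0ℤ * c132 + (c132 * c232 + (c133 * c332 + 0ℤ))))
        - (c330 * 0ℤ + (c331 * c112 + (c332 * 0ℤ + (c333 * c132 + 0ℤ))))
    identity = solve-∀

  plücker₀₃₄₅ : Pl₄ (γ c) 𝟎 𝟑 𝟒 𝟓 ≡ 0ℤ
  plücker₀₃₄₅ = viaAssoc₂ (identity c111 c120 c123 c130 c132 c133 c221 c230 c231 c232 c233 c331)
    (assocN 𝟏 𝟐 𝟑 𝟏) (sym (assocN 𝟏 𝟑 𝟐 𝟏))
    where
    identity : ∀ c111 c120 c123 c130 c132 c133 c221 c230 c231 c232 c233 c331 →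
      (- c123) * (- c331) - (- c133) * (- c231) + c132 * (- c221)
      ≡ ((c120 * 0ℤ + (0ℤ * 0ℤ + (0ℤ * c231 + (c123 * c331 + 0ℤ))))
          - (c230 * 1ℤ + (c231 * c111 + (c232 * 0ℤ + (c233 * 0ℤ + 0ℤ)))))
        + ((c230 * 1ℤ + (c231 * c111 + (c232 * 0ℤ + (c233 * 0ℤ + 0ℤ))))
          - (c130 * 0ℤ + (0ℤ * 0ℤ + (c132 * c221 + (c133 * c231 + 0ℤ)))))
    identity = solve-∀

  plücker₁₂₃₄ : Pl₄ (γ c) 𝟏 𝟐 𝟑 𝟒 ≡ 0ℤ
  plücker₁₂₃₄ = viaAssoc₂ (identity c111 c120 c123 c133 c220 c221 c222 c223 c230 c231 c232 c233 c333)
    (sym (assocN 𝟏 𝟐 𝟐 𝟏)) (sym (assocN 𝟐 𝟐 𝟑 𝟑))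
    where
    identity : ∀ c111 c120 c123 c133 c220 c221 c222 c223 c230 c231 c232 c233 c333 →
      (c133 - c111) * (- c221) - (- c223) * (- (c333 - c232)) + (c222 - c233) * (- c233)
      ≡ ((c220 * 1ℤ + (c221 * c111 + (c222 * 0ℤ + (c223 * 0ℤ + 0ℤ))))
          - (c120 * 0ℤ + (0ℤ * 0ℤ + (0ℤ * c221 + (c123 * c231 + 0ℤ)))))
        + ((c230 * 0ℤ + (c231 * c123 + (c232 * c223 + (c233 * c233 + 0ℤ))))
          - (c220 * 1ℤ + (c221 * c133 + (c222 * c233 + (c223 * c333 + 0ℤ)))))
    identity = solve-∀

  plücker₁₂₃₅ : Pl₄ (γ c) 𝟏 𝟐 𝟑 𝟓 ≡ 0ℤ
  plücker₁₂₃₅ = viaAssoc₂ (identity c111 c130 c132 c133 c220 c221 c222 c223 c230 c231 c232 c233 c332)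
    (sym (assocN 𝟏 𝟑 𝟐 𝟏)) (assocN 𝟐 𝟐 𝟑 𝟐)
    where
    identity : ∀ c111 c130 c132 c133 c220 c221 c222 c223 c230 c231 c232 c233 c332 →
      (c133 - c111) * (- c231) - (- c223) * c332 + c232 * (- c233)
      ≡ ((c230 * 1ℤ + (c231 * c111 + (c232 * 0ℤ + (c233 * 0ℤ + 0ℤ))))
          - (c130 * 0ℤ + (0ℤ * 0ℤ + (c132 * c221 + (c133 * c231 + 0ℤ)))))
        + ((c220 * 0ℤ + (c221 * c132 + (c222 * c232 + (c223 * c332 + 0ℤ))))
          - (c230 * 1ℤ + (c231 * 0ℤ + (c232 * c222 + (c233 * c232 + 0ℤ)))))
    identity = solve-∀

  plücker₁₂₄₅ : Pl₄ (γ c) 𝟏 𝟐 𝟒 𝟓 ≡ 0ℤ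
  plücker₁₂₄₅ = viaAssoc₂ (identity c111 c130 c132 c133 c222 c230 c231 c232 c233 c330 c331 c332 c333)
    (sym (assocN 𝟏 𝟑 𝟑 𝟏)) (assocN 𝟐 𝟑 𝟑 𝟐)
    where
    identity : ∀ c111 c130 c132 c133 c222 c230 c231 c232 c233 c330 c331 c332 c333 →
      (c133 - c111) * (- c331) - (c222 - c233) * c332 + c232 * (- (c333 - c232))
      ≡ ((c330 * 1ℤ + (c331 * c111 + (c332 * 0ℤ + (c333 * 0ℤ + 0ℤ))))
          - (c130 * 0ℤ + (0ℤ * 0ℤ + (c132 * c231 + (c133 * c331 + 0ℤ)))))
        + ((c230 * 0ℤ + (c231 * c132 + (c232 * c232 + (c233 * c332 + 0ℤ))))
          - (c330 * 1ℤ + (c331 * 0ℤ + (c332 * c222 + (c333 * c232 + 0ℤ)))))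
    identity = solve-∀

  open PlückerForms (antisymmetrise-alternating (γ⁺ c))

  plücker-at₁₂ : All (PlückerAt (γ c) 𝟏 𝟐) pairs
  plücker-at₁₂ =
      ends-at-i ∷ ends-at-j ∷ disjoint-bcad plücker₀₁₂₃ ∷ disjoint-bcad plücker₀₁₂₄ ∷ disjoint-bcad plücker₀₁₂₅
    ∷ starts-at-i ∷ starts-at-i ∷ starts-at-i ∷ starts-at-i
    ∷ starts-at-j ∷ starts-at-j ∷ starts-at-j
    ∷ disjoint-abcd plücker₁₂₃₄ ∷ disjoint-abcd plücker₁₂₃₅ ∷ disjoint-abcd plücker₁₂₄₅ ∷ []

  plücker-at₀₂ : All (PlückerAt (γ c) 𝟎 𝟐) pairs
  plücker-at₀₂ =
      starts-at-i ∷ starts-at-i ∷ starts-at-i ∷ starts-at-i ∷ starts-at-i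
    ∷ ends-at-j ∷ disjoint-acbd plücker₀₁₂₃ ∷ disjoint-acbd plücker₀₁₂₄ ∷ disjoint-acbd plücker₀₁₂₅
    ∷ starts-at-j ∷ starts-at-j ∷ starts-at-j
    ∷ disjoint-abcd plücker₀₂₃₄ ∷ disjoint-abcd plücker₀₂₃₅ ∷ disjoint-abcd plücker₀₂₄₅ ∷ []

  plücker-at₀₁ : All (PlückerAt (γ c) 𝟎 𝟏) pairs
  plücker-at₀₁ =
      starts-at-i ∷ starts-at-i ∷ starts-at-i ∷ starts-at-i ∷ starts-at-i
    ∷ starts-at-j ∷ starts-at-j ∷ starts-at-j ∷ starts-at-j
    ∷ disjoint-abcd plücker₀₁₂₃ ∷ disjoint-abcd plücker₀₁₂₄ ∷ disjoint-abcd plücker₀₁₂₅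
    ∷ disjoint-abcd plücker₀₁₃₄ ∷ disjoint-abcd plücker₀₁₃₅ ∷ disjoint-abcd plücker₀₁₄₅ ∷ []

  plücker-at₀₃ : All (PlückerAt (γ c) 𝟎 𝟑) pairs
  plücker-at₀₃ =
      starts-at-i ∷ starts-at-i ∷ starts-at-i ∷ starts-at-i ∷ starts-at-i
    ∷ disjoint-adbc plücker₀₁₂₃ ∷ ends-at-j ∷ disjoint-acbd plücker₀₁₃₄ ∷ disjoint-acbd plücker₀₁₃₅
    ∷ ends-at-j ∷ disjoint-acbd plücker₀₂₃₄ ∷ disjoint-acbd plücker₀₂₃₅
    ∷ starts-at-j ∷ starts-at-j
    ∷ disjoint-abcd plücker₀₃₄₅ ∷ []

-- In each case the rows of M_t, read as linear forms, are (under the case hypotheses) the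
-- kernel equations for the pivot pair (i, j) at the four indices outside {i, j}; at i and
-- j themselves the kernel equations hold trivially.
module Kernels (c : StructConst) where
  open Constants c

  private
    fromRow : ∀ {x y S} → S ≡ 0ℤ → x - y ≡ - S → x ≡ y
    fromRow S≡0 x-y≡-S = byZero x-y≡-S (cong -_ S≡0)

  kernel₁ : ∀ v → (∀ r → v · M₁ c r ≡ 0ℤ) →
    ∀ t → KernelEquation (γ c) 𝟏 𝟐 v t
  kernel₁ v K = λ where
      𝟎 → fromRow (K 𝟎) (row₀ (v 𝟎) (v 𝟏) (v 𝟐) (v 𝟑) (v 𝟒) (v 𝟓) c111 c112 c113 c133)
      𝟏 → sym (ℤP.+-identityʳ _)
      𝟐 → sym (ℤP.+-identityˡ _)
      𝟑 → fromRow (K 𝟏) (row₁ (v 𝟎) (v 𝟏) (v 𝟐) (v 𝟑) (v 𝟒) (v 𝟓) c111 c133 c223 c233)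
      𝟒 → fromRow (K 𝟐) (row₂ (v 𝟎) (v 𝟏) (v 𝟐) (v 𝟑) (v 𝟒) (v 𝟓) c111 c133 c222 c232 c233 c333)
      𝟓 → fromRow (K 𝟑) (row₃ (v 𝟎) (v 𝟏) (v 𝟐) (v 𝟑) (v 𝟒) (v 𝟓) c111 c133 c232 c332)
    where
    row₀ : ∀ v0 v1 v2 v3 v4 v5 c111 c112 c113 c133 →
      (c133 - c111) * v0 - (c112 * v1 + (- (- c113)) * v2)
      ≡ - (v0 * (- (c133 - c111)) + (v1 * c112 + (v2 * c113 + (v3 * 0ℤ + (v4 * 0ℤ + (v5 * 0ℤ + 0ℤ))))))
    row₀ = solve-∀
    row₁ : ∀ v0 v1 v2 v3 v4 v5 c111 c133 c223 c233 →
      (c133 - c111) * v3 - ((- (- c233)) * v1 + (- c223) * v2)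
      ≡ - (v0 * 0ℤ + (v1 * c233 + (v2 * (- c223) + (v3 * (- (c133 - c111)) + (v4 * 0ℤ + (v5 * 0ℤ + 0ℤ))))))
    row₁ = solve-∀
    row₂ : ∀ v0 v1 v2 v3 v4 v5 c111 c133 c222 c232 c233 c333 →
      (c133 - c111) * v4 - ((- (- (c333 - c232))) * v1 + (c222 - c233) * v2)
      ≡ - (v0 * 0ℤ + (v1 * (c333 - c232) + (v2 * (c222 - c233) + (v3 * 0ℤ + (v4 * (- (c133 - c111)) + (v5 * 0ℤ + 0ℤ))))))
    row₂ = solve-∀
    row₃ : ∀ v0 v1 v2 v3 v4 v5 c111 c133 c232 c332 →
      (c133 - c111) * v5 - ((- c332) * v1 + c232 * v2)
      ≡ - (v0 * 0ℤ + (v1 * (- c332) + (v2 * c232 + (v3 * 0ℤ + (v4 * 0ℤ + (v5 * (- (c133 - c111)) + 0ℤ))))))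
    row₃ = solve-∀

  kernel₂ : ℓ c ≡ 0ℤ → ∀ v → (∀ r → v · M₂ c r ≡ 0ℤ) →
    ∀ t → KernelEquation (γ c) 𝟎 𝟐 v t
  kernel₂ ℓ≡0 v K = λ where
      𝟎 → sym (ℤP.+-identityʳ _)
      𝟏 → trans (fromRow (K 𝟎) (row₀ (v 𝟎) (v 𝟏) (v 𝟐) (v 𝟑) (v 𝟒) (v 𝟓) c112 c113))
          (cong (λ h → h * v 𝟎 + γ c 𝟎 𝟏 * v 𝟐) (sym ℓ≡0))
      𝟐 → sym (ℤP.+-identityˡ _)
      𝟑 → fromRow (K 𝟏) (row₁ (v 𝟎) (v 𝟏) (v 𝟐) (v 𝟑) (v 𝟒) (v 𝟓) c112 c123 c233)
      𝟒 → fromRow (K 𝟐) (row₂ (v 𝟎) (v 𝟏) (v 𝟐) (v 𝟑) (v 𝟒) (v 𝟓) c112 c133 c232 c333)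
      𝟓 → fromRow (K 𝟑) (row₃ (v 𝟎) (v 𝟏) (v 𝟐) (v 𝟑) (v 𝟒) (v 𝟓) c112 c132 c332)
    where
    row₀ : ∀ v0 v1 v2 v3 v4 v5 c112 c113 →
      c112 * v1 - (0ℤ * v0 + (- c113) * v2)
      ≡ - (v0 * 0ℤ + (v1 * (- c112) + (v2 * (- c113) + (v3 * 0ℤ + (v4 * 0ℤ + (v5 * 0ℤ + 0ℤ))))))
    row₀ = solve-∀
    row₁ : ∀ v0 v1 v2 v3 v4 v5 c112 c123 c233 →
      c112 * v3 - ((- (- c233)) * v0 + (- c123) * v2)
      ≡ - (v0 * c233 + (v1 * 0ℤ + (v2 * (- c123) + (v3 * (- c112) + (v4 * 0ℤ + (v5 * 0ℤ + 0ℤ))))))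
    row₁ = solve-∀
    row₂ : ∀ v0 v1 v2 v3 v4 v5 c112 c133 c232 c333 →
      c112 * v4 - ((- (- (c333 - c232))) * v0 + (- c133) * v2)
      ≡ - (v0 * (c333 - c232) + (v1 * 0ℤ + (v2 * (- c133) + (v3 * 0ℤ + (v4 * (- c112) + (v5 * 0ℤ + 0ℤ))))))
    row₂ = solve-∀
    row₃ : ∀ v0 v1 v2 v3 v4 v5 c112 c132 c332 →
      c112 * v5 - ((- c332) * v0 + c132 * v2)
      ≡ - (v0 * (- c332) + (v1 * 0ℤ + (v2 * c132 + (v3 * 0ℤ + (v4 * 0ℤ + (v5 * (- c112) + 0ℤ))))))
    row₃ = solve-∀

  kernel₃ : ℓ c ≡ 0ℤ → c11² c ≡ 0ℤ → ∀ v → (∀ r → v · M₃ c r ≡ 0ℤ) →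
    ∀ t → KernelEquation (γ c) 𝟎 𝟏 v t
  kernel₃ ℓ≡0 c11²≡0 v K = λ where
      𝟎 → sym (ℤP.+-identityʳ _)
      𝟏 → sym (ℤP.+-identityˡ _)
      𝟐 → trans (fromRow (K 𝟎) (row₀ (v 𝟎) (v 𝟏) (v 𝟐) (v 𝟑) (v 𝟒) (v 𝟓) c113))
          (cong₂ (λ h h′ → (- h) * v 𝟎 + h′ * v 𝟏) (sym ℓ≡0) (sym c11²≡0))
      𝟑 → fromRow (K 𝟏) (row₁ (v 𝟎) (v 𝟏) (v 𝟐) (v 𝟑) (v 𝟒) (v 𝟓) c113 c123 c223)
      𝟒 → fromRow (K 𝟐) (row₂ (v 𝟎) (v 𝟏) (v 𝟐) (v 𝟑) (v 𝟒) (v 𝟓) c113 c133 c222 c233)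
      𝟓 → fromRow (K 𝟑) (row₃ (v 𝟎) (v 𝟏) (v 𝟐) (v 𝟑) (v 𝟒) (v 𝟓) c113 c132 c232)
    where
    row₀ : ∀ v0 v1 v2 v3 v4 v5 c113 →
      (- c113) * v2 - ((- 0ℤ) * v0 + 0ℤ * v1)
      ≡ - (v0 * 0ℤ + (v1 * 0ℤ + (v2 * c113 + (v3 * 0ℤ + (v4 * 0ℤ + (v5 * 0ℤ + 0ℤ))))))
    row₀ = solve-∀
    row₁ : ∀ v0 v1 v2 v3 v4 v5 c113 c123 c223 →
      (- c113) * v3 - ((- (- c223)) * v0 + (- c123) * v1)
      ≡ - (v0 * c223 + (v1 * (- c123) + (v2 * 0ℤ + (v3 * c113 + (v4 * 0ℤ + (v5 * 0ℤ + 0ℤ))))))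
    row₁ = solve-∀
    row₂ : ∀ v0 v1 v2 v3 v4 v5 c113 c133 c222 c233 →
      (- c113) * v4 - ((- (c222 - c233)) * v0 + (- c133) * v1)
      ≡ - (v0 * (- (c222 - c233)) + (v1 * (- c133) + (v2 * 0ℤ + (v3 * 0ℤ + (v4 * c113 + (v5 * 0ℤ + 0ℤ))))))
    row₂ = solve-∀
    row₃ : ∀ v0 v1 v2 v3 v4 v5 c113 c132 c232 →
      (- c113) * v5 - ((- c232) * v0 + c132 * v1)
      ≡ - (v0 * (- c232) + (v1 * c132 + (v2 * 0ℤ + (v3 * 0ℤ + (v4 * 0ℤ + (v5 * c113 + 0ℤ))))))
    row₃ = solve-∀

  kernel₄ : c11² c ≡ 0ℤ → c11³ c ≡ 0ℤ → ∀ v → (∀ r → v · M₄ c r ≡ 0ℤ) →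
    ∀ t → KernelEquation (γ c) 𝟎 𝟑 v t
  kernel₄ c11²≡0 c11³≡0 v K = λ where
      𝟎 → sym (ℤP.+-identityʳ _)
      𝟏 → trans (fromRow (K 𝟎) (row₀ (v 𝟎) (v 𝟏) (v 𝟐) (v 𝟑) (v 𝟒) (v 𝟓) c123 c223))
          (cong (λ h → γ c 𝟏 𝟑 * v 𝟎 + (- h) * v 𝟑) (sym c11³≡0))
      𝟐 → trans (fromRow (K 𝟏) (row₁ (v 𝟎) (v 𝟏) (v 𝟐) (v 𝟑) (v 𝟒) (v 𝟓) c123 c233))
          (cong (λ h → γ c 𝟐 𝟑 * v 𝟎 + h * v 𝟑) (sym c11²≡0))
      𝟑 → sym (ℤP.+-identityˡ _)
      𝟒 → fromRow (K 𝟐) (row₂ (v 𝟎) (v 𝟏) (v 𝟐) (v 𝟑) (v 𝟒) (v 𝟓) c123 c133 c221)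
      𝟓 → fromRow (K 𝟑) (row₃ (v 𝟎) (v 𝟏) (v 𝟐) (v 𝟑) (v 𝟒) (v 𝟓) c123 c132 c231)
    where
    row₀ : ∀ v0 v1 v2 v3 v4 v5 c123 c223 →
      (- c123) * v1 - ((- c223) * v0 + (- 0ℤ) * v3)
      ≡ - (v0 * (- c223) + (v1 * c123 + (v2 * 0ℤ + (v3 * 0ℤ + (v4 * 0ℤ + (v5 * 0ℤ + 0ℤ))))))
    row₀ = solve-∀
    row₁ : ∀ v0 v1 v2 v3 v4 v5 c123 c233 →
      (- c123) * v2 - ((- c233) * v0 + 0ℤ * v3)
      ≡ - (v0 * (- c233) + (v1 * 0ℤ + (v2 * c123 + (v3 * 0ℤ + (v4 * 0ℤ + (v5 * 0ℤ + 0ℤ))))))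
    row₁ = solve-∀
    row₂ : ∀ v0 v1 v2 v3 v4 v5 c123 c133 c221 →
      (- c123) * v4 - ((- (- c221)) * v0 + (- c133) * v3)
      ≡ - (v0 * c221 + (v1 * 0ℤ + (v2 * 0ℤ + (v3 * (- c133) + (v4 * c123 + (v5 * 0ℤ + 0ℤ))))))
    row₂ = solve-∀
    row₃ : ∀ v0 v1 v2 v3 v4 v5 c123 c132 c231 →
      (- c123) * v5 - ((- (- c231)) * v0 + c132 * v3)
      ≡ - (v0 * c231 + (v1 * 0ℤ + (v2 * 0ℤ + (v3 * c132 + (v4 * 0ℤ + (v5 * c123 + 0ℤ))))))
    row₃ = solve-∀


-- Case t is `algorithm-correct` for the pivot pair
-- (2,3), (1,3), (1,2), (1,4) respectively (1-based), whose γ-entry is the numerator of k.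
mainTheorem4 : (c : StructConst) → IsQuarticOrder c → IsNormalized c →
      (ℓ c ≢ 0ℤ →
        AlgorithmOutputParametrizes c (M₁ c) (ℓ c)
          (λ V → V (# 4) (# 1) * V (# 5) (# 2) - V (# 4) (# 2) * V (# 5) (# 1)))
    × (ℓ c ≡ 0ℤ → c11² c ≢ 0ℤ →
        AlgorithmOutputParametrizes c (M₂ c) (c11² c)
          (λ V → V (# 4) (# 0) * V (# 5) (# 2)))
    × (ℓ c ≡ 0ℤ → c11² c ≡ 0ℤ → c11³ c ≢ 0ℤ →
        AlgorithmOutputParametrizes c (M₃ c) (- c11³ c)
          (λ V → V (# 4) (# 0) * V (# 5) (# 1)))
    × (ℓ c ≡ 0ℤ → c11² c ≡ 0ℤ → c11³ c ≡ 0ℤ → c12³ c ≢ 0ℤ →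
        AlgorithmOutputParametrizes c (M₄ c) (- c12³ c)
          (λ V → V (# 4) (# 0) * V (# 5) (# 3)))
mainTheorem4 c Q normalised =
    (λ ℓ≢0 →
       algorithm-correct c (M₁ c) 𝟏 𝟐 _ ℓ≢0 (kernel₁ c) plücker-at₁₂ (λ V _ → refl))
  , (λ ℓ≡0 c11²≢0 →
       algorithm-correct c (M₂ c) 𝟎 𝟐 _ c11²≢0 (kernel₂ c ℓ≡0) plücker-at₀₂ (λ V → leading-minor V 𝟐))
  , (λ ℓ≡0 c11²≡0 c11³≢0 →
       algorithm-correct c (M₃ c) 𝟎 𝟏 _ (neg≢0 c11³≢0) (kernel₃ c ℓ≡0 c11²≡0) plücker-at₀₁
         (λ V → leading-minor V 𝟏))
  , (λ _ c11²≡0 c11³≡0 c12³≢0 →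
       algorithm-correct c (M₄ c) 𝟎 𝟑 _ (neg≢0 c12³≢0) (kernel₄ c c11²≡0 c11³≡0) plücker-at₀₃
         (λ V → leading-minor V 𝟑))
  where
  open Kernels
  open PlückerRelations c Q normalised
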